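{- The class $\mathcal{C}_{\text{Pencil}}$ of Pencil frames is not modally definable: there is no formula $\varphi$ of the language $\mathcal{L}_{\Box,\triangleright}$ such that for every Veltman frame $\mathcal{F}$ we have $\mathcal{F}\models\varphi$ if and only if $\mathcal{F}\in\mathcal{C}_{\text{Pencil}}$.
   Context: Formulas of $\mathcal{L}_{\Box,\triangleright}$ are built from a countably infinite set of propositional atoms by the grammar $\alpha ::= p \mid \bot \mid \alpha\to\alpha \mid \Box\alpha \mid \alpha\triangleright\alpha$; the other Boolean connectives are defined as usual, and $\Diamond\alpha := \neg\Box\neg\alpha$. A Veltman frame is a triple $\mathcal{F}=\langle W,R,\{S_w\}_{w\in W}\rangle$ with the following properties. $W$ is a nonempty set. $R$ is a transitive binary relation on $W$ that is conversely well-founded, meaning there is no infinite chain $w_0Rw_1Rw_2R\cdots$. For each $w\in W$, $S_w$ is a reflexive and transitive binary relation on $R[w]:=\{v: wRv\}$ such that for all $u,v\in R[w]$, $uRv$ implies $uS_wv$. A Veltman model adds a valuation $ev$ assigning to each atom a subset of $W$. Forcing is defined as follows: - $w\Vdash p$ iff $w\in ev(p)$. - $w\not\Vdash\bot$. - Implication is classical. - $w\Vdash\Box\alpha$ iff every $v$ with $wRv$ forces $\alpha$. - $w\Vdash\alpha\triangleright\beta$ iff for every $u$ with $wRu$ and $u\Vdash\alpha$ there is $v$ with $uS_wv$ and $v\Vdash\beta$. A frame validates $\varphi$, written $\mathcal{F}\models\varphi$, if $\varphi$ is forced at every world under every valuation. $\mathcal{C}_{\text{Pencil}}$ is the class of Veltman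 frames satisfying: for all $x,y,z,u,v\in W$, if $xRy$, $yS_xz$, $zRu$, $yRv$ and $vS_xu$, then $yRu$. -}

module Defs where

open import Data.Nat using (ℕ; suc)
open import Data.Empty using (⊥)
open import Data.Product using (Σ; _×_)
open import Relation.Nullary using (¬_)
open import Function.Bundles using (_⇔_)

data Form : Set where
  atom : ℕ → Form
  ⊥'   : Form
  _⇒_  : Form → Form → Form
  □_   : Form → Form
  _▷_  : Form → Form → Form

infixr 5 _⇒_
infix 6 _▷_

-- Veltman frames.  S w u v  means  u S_w v.
record VeltmanFrame : Set₁ where
  field
    W      : Set
    R      : W → W → Set
    S      : W → W → W → Set
    R-trans : ∀ {x y z} → R x y → R y z → R x z
    R-cwf  : ¬ (Σ (ℕ → W) λ f → ∀ n → R (f n) (f (suc n)))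
    S-dom  : ∀ {w u v} → S w u v → R w u × R w v
    S-refl : ∀ {w u} → R w u → S w u u
    S-trans : ∀ {w u v t} → S w u v → S w v t → S w u t
    R⊆S    : ∀ {w u v} → R w u → R w v → R u v → S w u v

module _ (F : VeltmanFrame) where
  open VeltmanFrame F

  Valuation : Set₁
  Valuation = ℕ → W → Set

  _,_⊩_ : Valuation → W → Form → Set
  ev , w ⊩ atom p  = ev p w
  ev , w ⊩ ⊥'      = ⊥
  ev , w ⊩ (a ⇒ b) = ev , w ⊩ a → ev , w ⊩ b
  ev , w ⊩ (□ a)   = ∀ v → R w v → ev , v ⊩ a
  ev , w ⊩ (a ▷ b) = ∀ u → R w u → ev , u ⊩ a → Σ W λ v → S w u v × ev , v ⊩ b

_⊨_ : VeltmanFrame → Form → Set₁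
F ⊨ φ = ∀ (ev : Valuation F) (w : VeltmanFrame.W F) → _,_⊩_ F ev w φ

Pencil : VeltmanFrame → Set
Pencil F = ∀ {x y z u v} → R x y → S x y z → R z u → R y v → S x v u → R y u
  where open VeltmanFrame F

ModallyDefinable : (VeltmanFrame → Set) → Set₁
ModallyDefinable C = Σ Form λ φ → ∀ (F : VeltmanFrame) → (F ⊨ φ) ⇔ C F

{-# OPTIONS --safe #-}
module Submission where

open import Defs
open import Relation.Nullary using (¬_)
open import Data.Nat using (ℕ; suc)
open import Data.Empty using (⊥)
open import Data.Product using (Σ; ∃; _×_; _,_)
open import Function.Base using (_∘_)
open import Function.Bundles using (_⇔_; mk⇔; Equivalence)
open import Relation.Binary.PropositionalEquality using (_≡_; refl)

-- Validity of a formula is reflected along surjective bounded morphisms of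
-- Veltman frames. The five-world frame `merged` fails the Pencil condition only
-- because the world u is both R-above z and S_x-after v. Splitting u into u₁
-- (R-above z) and u₂ (S_x-after v) gives a Pencil frame `split`, and identifying
-- u₁ with u₂ is a surjective bounded morphism onto `merged`. A formula defining
-- the Pencil frames would thus be valid on `split`, hence on `merged`.

module _ (F G : VeltmanFrame) where
  private
    module F = VeltmanFrame F
    module G = VeltmanFrame G

  record BoundedMorphism : Set where
    field
      map     : F.W → G.W
      R-forth : ∀ {w v} → F.R w v → G.R (map w) (map v)
      R-back  : ∀ {w v′} → G.R (map w) v′ → Σ F.W λ v → F.R w v × map v ≡ v′
      S-forth : ∀ {w u v} → F.S w u v → G.S (map w) (map u) (map v)
      S-back  : ∀ {w u v′} → F.R w u → G.S (map w) (map u) v′ →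
                Σ F.W λ v → F.S w u v × map v ≡ v′

    pullback : Valuation G → Valuation F
    pullback V p = V p ∘ map

    Surjective : Set
    Surjective = ∀ g → ∃ λ w → map w ≡ g

module _ {F G : VeltmanFrame} (f : BoundedMorphism F G) (V : Valuation G) where
  open BoundedMorphism f

  private
    _⊩ᶠ_ : VeltmanFrame.W F → Form → Set
    w ⊩ᶠ φ = _,_⊩_ F (pullback V) w φ

    _⊩ᵍ_ : VeltmanFrame.W G → Form → Set
    w ⊩ᵍ φ = _,_⊩_ G V w φ

  ⊩-map : ∀ φ w → w ⊩ᶠ φ ⇔ map w ⊩ᵍ φ
  ⊩-map (atom p) w = mk⇔ (λ h → h) (λ h → h)
  ⊩-map ⊥'       w = mk⇔ (λ h → h) (λ h → h)
  ⊩-map (a ⇒ b)  w = mk⇔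
    (λ h → Equivalence.to   (⊩-map b w) ∘ h ∘ Equivalence.from (⊩-map a w))
    (λ h → Equivalence.from (⊩-map b w) ∘ h ∘ Equivalence.to   (⊩-map a w))
  ⊩-map (□ a)    w = mk⇔ to from
    where
    to : w ⊩ᶠ (□ a) → map w ⊩ᵍ (□ a)
    to h v′ wRv′ with R-back wRv′
    ... | v , wRv , refl = Equivalence.to (⊩-map a v) (h v wRv)
    from : map w ⊩ᵍ (□ a) → w ⊩ᶠ (□ a)
    from h v wRv = Equivalence.from (⊩-map a v) (h (map v) (R-forth wRv))
  ⊩-map (a ▷ b)  w = mk⇔ to from
    where
    to : w ⊩ᶠ (a ▷ b) → map w ⊩ᵍ (a ▷ b)
    to h u′ wRu′ u′⊩a with R-back wRu′
    ... | u , wRu , refl with h u wRu (Equivalence.from (⊩-map a u) u′⊩a)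
    ... | v , uSv , v⊩b = map v , S-forth uSv , Equivalence.to (⊩-map b v) v⊩b
    from : map w ⊩ᵍ (a ▷ b) → w ⊩ᶠ (a ▷ b)
    from h u wRu u⊩a with h (map u) (R-forth wRu) (Equivalence.to (⊩-map a u) u⊩a)
    ... | v′ , uSv′ , v′⊩b with S-back wRu uSv′
    ... | v , uSv , refl = v , uSv , Equivalence.from (⊩-map b v) v′⊩b

⊨-image : ∀ {F G φ} (f : BoundedMorphism F G) → BoundedMorphism.Surjective f →
          F ⊨ φ → G ⊨ φ
⊨-image {φ = φ} f onto F⊨φ V g with onto g
... | w , refl = Equivalence.to (⊩-map f V φ w) (F⊨φ (BoundedMorphism.pullback f V) w)

definable-image : ∀ {C F G} → ModallyDefinable C →
                  (f : BoundedMorphism F G) → BoundedMorphism.Surjective f →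
                  C F → C G
definable-image {F = F} {G} (φ , defines) f onto CF =
  Equivalence.to (defines G) (⊨-image {φ = φ} f onto (Equivalence.from (defines F) CF))

no-3-chain⇒cwf : {A : Set} {R : A → A → Set} →
                 (∀ {a b c d} → R a b → R b c → R c d → ⊥) →
                 ¬ (Σ (ℕ → A) λ f → ∀ n → R (f n) (f (suc n)))
no-3-chain⇒cwf no-3-chain (_ , step) = no-3-chain (step 0) (step 1) (step 2)

module Merged where

  data W : Set where
    x y z u v : W

  data R : W → W → Set where
    xy : R x y
    xz : R x z
    xu : R x u
    xv : R x v
    zu : R z u
    yv : R y v

  data S : W → W → W → Set where
    S-refl : ∀ {w a} → R w a → S w a a
    yz : S x y z
    zu : S x z u
    yv : S x y v
    vu : S x v u
    yu : S x y u

  R-trans : ∀ {a b c} → R a b → R b c → R a c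
  R-trans xy yv = xv
  R-trans xz zu = xu

  R-cwf : ¬ (Σ (ℕ → W) λ f → ∀ n → R (f n) (f (suc n)))
  R-cwf = no-3-chain⇒cwf {R = R} no-3-chain
    where
    no-3-chain : ∀ {a b c d} → R a b → R b c → R c d → ⊥
    no-3-chain xy yv ()
    no-3-chain xz zu ()

  S-dom : ∀ {w a b} → S w a b → R w a × R w b
  S-dom (S-refl r) = r , r
  S-dom yz = xy , xz
  S-dom zu = xz , xu
  S-dom yv = xy , xv
  S-dom vu = xv , xu
  S-dom yu = xy , xu

  S-trans : ∀ {w a b c} → S w a b → S w b c → S w a c
  S-trans (S-refl _) q = q
  S-trans p (S-refl _) = p
  S-trans yz zu = yu
  S-trans yv vu = yu

  R⊆S : ∀ {w a b} → R w a → R w b → R a b → S w a b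
  R⊆S xz xu zu = zu
  R⊆S xy xv yv = yv

merged : VeltmanFrame
merged = record { Merged }

merged-¬Pencil : ¬ Pencil merged
merged-¬Pencil pencil with pencil Merged.xy Merged.yz Merged.zu Merged.yv Merged.vu
... | ()

module Split where

  data W : Set where
    x y z u₁ u₂ v : W

  data R : W → W → Set where
    xy  : R x y
    xz  : R x z
    xu₁ : R x u₁
    xu₂ : R x u₂
    xv  : R x v
    zu₁ : R z u₁
    yv  : R y v

  data S : W → W → W → Set where
    S-refl : ∀ {w a} → R w a → S w a a
    yz  : S x y z
    zu₁ : S x z u₁
    yv  : S x y v
    vu₂ : S x v u₂
    yu₁ : S x y u₁
    yu₂ : S x y u₂

  R-trans : ∀ {a b c} → R a b → R b c → R a c
  R-trans xy yv = xv
  R-trans xz zu₁ = xu₁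

  R-cwf : ¬ (Σ (ℕ → W) λ f → ∀ n → R (f n) (f (suc n)))
  R-cwf = no-3-chain⇒cwf {R = R} no-3-chain
    where
    no-3-chain : ∀ {a b c d} → R a b → R b c → R c d → ⊥
    no-3-chain xy yv ()
    no-3-chain xz zu₁ ()

  S-dom : ∀ {w a b} → S w a b → R w a × R w b
  S-dom (S-refl r) = r , r
  S-dom yz = xy , xz
  S-dom zu₁ = xz , xu₁
  S-dom yv = xy , xv
  S-dom vu₂ = xv , xu₂
  S-dom yu₁ = xy , xu₁
  S-dom yu₂ = xy , xu₂

  S-trans : ∀ {w a b c} → S w a b → S w b c → S w a c
  S-trans (S-refl _) q = q
  S-trans p (S-refl _) = p
  S-trans yz zu₁ = yu₁
  S-trans yv vu₂ = yu₂

  R⊆S : ∀ {w a b} → R w a → R w b → R a b → S w a b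
  R⊆S xz xu₁ zu₁ = zu₁
  R⊆S xy xv yv = yv

split : VeltmanFrame
split = record { Split }

split-Pencil : Pencil split
split-Pencil _ _ Split.zu₁ Split.zu₁ _ = Split.zu₁
split-Pencil _ _ Split.yv  Split.yv  _ = Split.yv
split-Pencil _ _ Split.zu₁ Split.yv  ()
split-Pencil _ _ Split.yv  Split.zu₁ ()

collapse : BoundedMorphism split merged
collapse = record
  { map = map ; R-forth = R-forth ; R-back = R-back
  ; S-forth = S-forth ; S-back = S-back }
  where
  open Split
  open Merged using (x; y; z; u; v)

  map : Split.W → Merged.W
  map x  = x
  map y  = y
  map z  = z
  map u₁ = u
  map u₂ = u
  map v  = v

  R-forth : ∀ {a b} → Split.R a b → Merged.R (map a) (map b)
  R-forth xy  = Merged.xy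
  R-forth xz  = Merged.xz
  R-forth xu₁ = Merged.xu
  R-forth xu₂ = Merged.xu
  R-forth xv  = Merged.xv
  R-forth zu₁ = Merged.zu
  R-forth yv  = Merged.yv

  R-back : ∀ {a b′} → Merged.R (map a) b′ → Σ Split.W λ b → Split.R a b × map b ≡ b′
  R-back {x} Merged.xy = y  , xy  , refl
  R-back {x} Merged.xz = z  , xz  , refl
  R-back {x} Merged.xu = u₁ , xu₁ , refl
  R-back {x} Merged.xv = v  , xv  , refl
  R-back {z} Merged.zu = u₁ , zu₁ , refl
  R-back {y} Merged.yv = v  , yv  , refl

  S-forth : ∀ {w a b} → Split.S w a b → Merged.S (map w) (map a) (map b)
  S-forth (S-refl r) = Merged.S-refl (R-forth r)
  S-forth yz  = Merged.yz
  S-forth zu₁ = Merged.zu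
  S-forth yv  = Merged.yv
  S-forth vu₂ = Merged.vu
  S-forth yu₁ = Merged.yu
  S-forth yu₂ = Merged.yu

  S-back : ∀ {w a b′} → Split.R w a → Merged.S (map w) (map a) b′ →
           Σ Split.W λ b → Split.S w a b × map b ≡ b′
  S-back xy Merged.yz = z  , yz  , refl
  S-back xz Merged.zu = u₁ , zu₁ , refl
  S-back xy Merged.yv = v  , yv  , refl
  S-back xv Merged.vu = u₂ , vu₂ , refl
  S-back xy Merged.yu = u₁ , yu₁ , refl
  S-back r  (Merged.S-refl _) = _ , S-refl r , refl

collapse-surjective : BoundedMorphism.Surjective collapse
collapse-surjective Merged.x = Split.x  , refl
collapse-surjective Merged.y = Split.y  , refl
collapse-surjective Merged.z = Split.z  , refl
collapse-surjective Merged.u = Split.u₁ , refl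
collapse-surjective Merged.v = Split.v  , refl

theorem3p1 : ¬ ModallyDefinable Pencil
theorem3p1 definable =
  merged-¬Pencil (definable-image definable collapse collapse-surjective split-Pencil)
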